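{- Let $q\ge0$, $k$, $r$ be integers with $k\ge 2q+3$ and $2\le r\le k-q-1$. There exists $n_0$ such that for all $n\ge n_0$ the following holds. Let $\mathcal{H}$ be a Berge-$M_{k+1}$-free $r$-uniform hypergraph on $n$ vertices with \[ |E(\mathcal{H})|>h_r(n,k,k-q)=\binom{k+1+q}{r}+(n-k-1-q)\binom{k-q}{r-1}. \] Then there exists a vertex set $S\subseteq V(\mathcal{H})$ with $k-q\le|S|\le k$ such that the hypergraph $\mathcal{H}_0$ is Berge-$M_{k+1-|S|}$-free, where $V(\mathcal{H}_0)=V(\mathcal{H})\setminus S$ and \[ E(\mathcal{H}_0)=\{\,e\setminus S : e\in E(\mathcal{H}),\ |e\cap(V(\mathcal{H})\setminus S)|\ge 2\,\}, \] taken as a multiset (so $\mathcal{H}_0$ need not be uniform and may have parallel edges).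
   Context: $M_k$ denotes the graph matching with $k$ edges. For a graph $F$, a (possibly non-uniform, possibly multi-) hypergraph $\mathcal{B}$ is a Berge-$F$ if there is a bijection $\phi:E(F)\to E(\mathcal{B})$ with $e\subseteq\phi(e)$ for all $e\in E(F)$; a hypergraph is Berge-$F$-free if it contains no subhypergraph that is a Berge-$F$. $h_r(n,k,t)=\binom{2k+1-t}{r}+(n-2k-1+t)\binom{t}{r-1}$. -}

module Defs where

open import Data.Nat using (ℕ; _≤?_; _+_; _*_; _∸_)
open import Data.Nat.Combinatorics using (_C_)
open import Data.Fin using (Fin)
open import Data.Fin.Subset using (Subset; _∈_; ∣_∣; _∩_; _─_; ∁)
open import Data.List using (List; length; lookup; map; filter)
open import Data.Product using (Σ; _×_)
open import Relation.Binary.PropositionalEquality using (_≡_; _≢_)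
open import Relation.Nullary using (¬_)
open import Function.Definitions using (Injective)

h : ℕ → ℕ → ℕ → ℕ → ℕ
h r n k t = ((2 * k + 1 ∸ t) C r) + (n + t ∸ (2 * k + 1)) * (t C (r ∸ 1))

-- A (multi-)hypergraph on vertex set Fin n is a list of edges (subsets);
-- parallel edges are distinct list positions.
HasBergeMatching : {n : ℕ} → List (Subset n) → ℕ → Set
HasBergeMatching {n} E m =
  Σ (Fin m → Fin (length E)) λ f → Injective _≡_ _≡_ f ×
  Σ (Fin m → Fin n) λ u → Σ (Fin m → Fin n) λ v →
    (∀ i → u i ≢ v i) ×
    (∀ i j → i ≢ j → (u i ≢ u j) × (u i ≢ v j) × (v i ≢ v j)) ×
    (∀ i → (u i ∈ lookup E (f i)) × (v i ∈ lookup E (f i)))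

BergeMatchingFree : {n : ℕ} → List (Subset n) → ℕ → Set
BergeMatchingFree E m = ¬ HasBergeMatching E m

reduce : {n : ℕ} → Subset n → List (Subset n) → List (Subset n)
reduce S E = map (λ e → e ─ S) (filter (λ e → 2 ≤? ∣ e ∩ ∁ S ∣) E)

-- Let K = k + 1 and call a vertex rich if its degree exceeds Δ = K + C(2K, r).  A Berge
-- matching with at most K edges can be extended greedily through rich vertices, one at a
-- time: of the edges through a rich vertex at most K are already used and at most C(2K, r)
-- lie inside the at most 2K vertices to be avoided.  So the set S of rich vertices has fewer
-- than K elements, and a Berge matching of H₀ (whose edges avoid S) of size K − |S| extends
-- to a Berge-M_K in H.  The edges with two vertices outside S are few: greedily, more than
-- 2KΔ of them would already contain a Berge-M_K, as every vertex outside S meets at most Δ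
-- edges.  The other edges number at most C(|S|, r) + n C(|S|, r − 1), and if |S| < k − q
-- the total is below h_r(n, k, k − q) for large n because C(k − q, r − 1) > C(k − q − 1, r − 1).

module Submission where

open import Defs
open import Data.Nat using (ℕ; zero; suc; _≤_; _≤′_; ≤′-refl; ≤′-step; _<_; _+_; _*_; _∸_; z≤n; s≤s; _≤?_; _<?_; _≟_)
open import Data.Nat.Properties hiding (suc-injective)
import Data.Nat.Properties as ℕ
open import Data.Nat.Combinatorics using (_C_; nCk+nC[k+1]≡[n+1]C[k+1])
open import Data.Nat.ListAction using (sum)
open import Data.Nat.Tactic.RingSolver using (solve-∀)
open import Data.Bool using (true; false)
open import Data.Fin using (Fin; zero; suc)
open import Data.Fin.Properties as Fin using ()
open import Data.Vec using ([]; _∷_; here; there)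
import Data.Vec.Properties as Vec
import Data.Bool as Bool
import Data.List.Membership.DecPropositional as DecMembership
open import Data.Fin.Subset using (Subset; _∈_; _∉_; ∣_∣; _∩_; _∪_; _─_; ∁; ⊥; ⁅_⁆)
open import Data.Fin.Subset.Properties using (_∈?_; p─q⊆p; ∣p∣≤n; x∈⁅x⁆; ∣⁅x⁆∣≡1; ∣⊥∣≡0; ∣p∣≤∣x∷p∣; x∈p∪q⁺; x∈p∩q⁻; x∈∁p⇒x∉p)
open import Data.List using (List; []; _∷_; length; filter; map; lookup; tabulate; take; _++_)
open import Data.List.Properties using (length-take; length-++; length-map; length-tabulate; filter-none; filter-all)
open import Data.List.Relation.Unary.All as All using (All; []; _∷_; all?)
open import Data.List.Relation.Unary.All.Properties as All using (all-filter; ¬All⇒Any¬; ¬Any⇒All¬)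
open import Data.List.Relation.Unary.Any as Any using (Any; here; there; any?; index)
open import Data.List.Relation.Unary.Any.Properties using (lookup-index)
open import Data.List.Relation.Unary.AllPairs using ([]; _∷_)
open import Data.List.Relation.Unary.Unique.Propositional using (Unique)
open import Data.List.Relation.Unary.Unique.Propositional.Properties as Unique using ()
open import Data.List.Membership.Propositional using (find) renaming (_∈_ to _∈ₗ_; _∉_ to _∉ₗ_)
open import Data.List.Membership.Propositional.Properties using (∈-tabulate⁺; ∈-tabulate⁻; ∈-filter⁻; ∈-++⁺ˡ; ∈-++⁺ʳ; ∈-++⁻; ∈-∃++)
open import Data.List.Relation.Binary.Sublist.Propositional.Properties using (filter-⊆; filter⁺; length-mono-≤)
open import Data.Empty using () renaming (⊥ to ⊥₀)
open import Data.Sum using (_⊎_; inj₁; inj₂)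
open import Data.Product using (Σ; ∃; _×_; _,_; proj₁; proj₂; map₂)
open import Function using (_∘_; id)
open import Function.Definitions using (Injective)
open import Level using (0ℓ)
open import Relation.Binary.PropositionalEquality
open import Relation.Nullary using (¬_; ¬?; Dec; yes; no; does; contradiction)
open import Relation.Nullary.Decidable using (_⊎-dec_; toSum)
open import Relation.Unary using (Pred; Decidable)

private
  variable
    A : Set
    n m : ℕ

module _ {P Q : Pred A 0ℓ} (P? : Decidable P) (Q? : Decidable Q) where

  length≤filter+filter : ∀ {xs} → All (λ x → P x ⊎ Q x) xs →
    length xs ≤ length (filter P? xs) + length (filter Q? xs)
  length≤filter+filter {[]} [] = z≤n
  length≤filter+filter {x ∷ xs} (pq ∷ pqs) with ih ← length≤filter+filter pqs | P? x | Q? x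
  ... | yes _ | yes _ = s≤s (≤-trans ih (+-monoʳ-≤ _ (n≤1+n _)))
  ... | yes _ | no  _ = s≤s ih
  ... | no  _ | yes _ = ≤-trans (s≤s ih) (≤-reflexive (sym (+-suc _ _)))
  ... | no ¬p | no ¬q with pq
  ...   | inj₁ p = contradiction p ¬p
  ...   | inj₂ q = contradiction q ¬q

length-filter∘filter≤ : {P Q : Pred A 0ℓ} (P? : Decidable P) (Q? : Decidable Q) (xs : List A) →
  length (filter P? (filter Q? xs)) ≤ length (filter P? xs)
length-filter∘filter≤ P? Q? xs = length-mono-≤ (filter⁺ P? P? (λ { refl p → p }) (filter-⊆ Q? xs))

unique⇒length≤ : {xs ys : List A} → Unique xs → All (_∈ₗ ys) xs → length xs ≤ length ys
unique⇒length≤ {xs = []} _ _ = z≤n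
unique⇒length≤ {xs = x ∷ xs} (x∉xs ∷ xs-unique) (x∈ys ∷ xs⊆ys) with ∈-∃++ x∈ys
... | ys₁ , ys₂ , refl = begin
  suc (length xs)                ≤⟨ s≤s (unique⇒length≤ xs-unique (All.zipWith drop-x (x∉xs , xs⊆ys))) ⟩
  suc (length (ys₁ ++ ys₂))      ≡⟨ cong suc (length-++ ys₁) ⟩
  suc (length ys₁ + length ys₂)  ≡⟨ +-suc (length ys₁) (length ys₂) ⟨
  length ys₁ + length (x ∷ ys₂)  ≡⟨ length-++ ys₁ ⟨
  length (ys₁ ++ x ∷ ys₂)        ∎
  where
  open ≤-Reasoning
  drop-x : ∀ {y} → x ≢ y × y ∈ₗ ys₁ ++ x ∷ ys₂ → y ∈ₗ ys₁ ++ ys₂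
  drop-x (x≢y , y∈) with ∈-++⁻ ys₁ y∈
  ... | inj₁ y∈ys₁         = ∈-++⁺ˡ y∈ys₁
  ... | inj₂ (here y≡x)    = contradiction (sym y≡x) x≢y
  ... | inj₂ (there y∈ys₂) = ∈-++⁺ʳ ys₁ y∈ys₂

private
  pascal : ∀ m k → m C k + m C suc k ≡ suc m C suc k
  pascal = nCk+nC[k+1]≡[n+1]C[k+1]

∉⇒≢ : {x y : A} {xs : List A} → x ∉ₗ xs → y ∈ₗ xs → x ≢ y
∉⇒≢ x∉xs y∈xs refl = x∉xs y∈xs

map∘filter-position : {B : Set} {P : Pred A 0ℓ} (h : A → B) (P? : Decidable P) (xs : List A) →
  Σ (Fin (length (map h (filter P? xs))) → Fin (length xs)) λ pos →
    Injective _≡_ _≡_ pos × (∀ i → lookup (map h (filter P? xs)) i ≡ h (lookup xs (pos i)))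
map∘filter-position h P? [] = (λ ()) , (λ { {()} }) , λ ()
map∘filter-position h P? (x ∷ xs) with P? x | map∘filter-position h P? xs
... | no  _ | pos , pos-injective , pos-lookup = suc ∘ pos , pos-injective ∘ Fin.suc-injective , pos-lookup
... | yes _ | pos , pos-injective , pos-lookup = pos′ , pos′-injective , pos′-lookup
  where
  pos′ : Fin (suc (length (map h (filter P? xs)))) → Fin (suc (length xs))
  pos′ zero    = zero
  pos′ (suc i) = suc (pos i)
  pos′-injective : Injective _≡_ _≡_ pos′
  pos′-injective {zero}  {zero}  _  = refl
  pos′-injective {suc i} {suc j} eq = cong suc (pos-injective (Fin.suc-injective eq))
  pos′-lookup : ∀ i → lookup (h x ∷ map h (filter P? xs)) i ≡ h (lookup (x ∷ xs) (pos′ i))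
  pos′-lookup zero    = refl
  pos′-lookup (suc i) = pos-lookup i

sum≤length* : (f : A → ℕ) {b : ℕ} {xs : List A} → All (λ x → f x ≤ b) xs → sum (map f xs) ≤ length xs * b
sum≤length* f [] = z≤n
sum≤length* f (fx≤b ∷ fxs≤b) = +-mono-≤ fx≤b (sum≤length* f fxs≤b)

C-≤-suc : ∀ m k → m C k ≤ suc m C k
C-≤-suc m zero    = ≤-refl
C-≤-suc m (suc k) = ≤-trans (m≤n+m _ (m C k)) (≤-reflexive (pascal m k))

C-monoˡ-≤ : ∀ {m m′} k → m ≤ m′ → m C k ≤ m′ C k
C-monoˡ-≤ k = go ∘ ≤⇒≤′
  where
  go : ∀ {m m′} → m ≤′ m′ → m C k ≤ m′ C k
  go ≤′-refl       = ≤-refl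
  go (≤′-step m≤′) = ≤-trans (go m≤′) (C-≤-suc _ k)

C-pos : ∀ {m} k → k ≤ m → 0 < m C k
C-pos zero    _           = s≤s z≤n
C-pos (suc k) (s≤s k≤m) = ≤-trans (C-pos k k≤m) (≤-trans (m≤m+n _ _) (≤-reflexive (pascal _ k)))

∣p∪q∣≤∣p∣+∣q∣ : (p q : Subset n) → ∣ p ∪ q ∣ ≤ ∣ p ∣ + ∣ q ∣
∣p∪q∣≤∣p∣+∣q∣ []          []          = z≤n
∣p∪q∣≤∣p∣+∣q∣ (true ∷ p)  (b ∷ q)     = s≤s (≤-trans (∣p∪q∣≤∣p∣+∣q∣ p q) (+-monoʳ-≤ ∣ p ∣ (∣p∣≤∣x∷p∣ b q)))
∣p∪q∣≤∣p∣+∣q∣ (false ∷ p) (true ∷ q)  = ≤-trans (s≤s (∣p∪q∣≤∣p∣+∣q∣ p q)) (≤-reflexive (sym (+-suc ∣ p ∣ ∣ q ∣)))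
∣p∪q∣≤∣p∣+∣q∣ (false ∷ p) (false ∷ q) = ∣p∪q∣≤∣p∣+∣q∣ p q

x∈p─q⇒x∉q : ∀ {p q : Subset n} {x} → x ∈ p ─ q → x ∉ q
x∈p─q⇒x∉q {p = true ∷ p} {false ∷ q} here      ()
x∈p─q⇒x∉q {p = _ ∷ p}    {_ ∷ q}     (there x∈) (there x∈q) = x∈p─q⇒x∉q x∈ x∈q

nonempty : (p : Subset n) → 0 < ∣ p ∣ → ∃ (_∈ p)
nonempty (true ∷ p)  _ = zero , here
nonempty (false ∷ p) ∣p∣>0 with nonempty p ∣p∣>0
... | x , x∈p = suc x , there x∈p

two-elements : (p : Subset n) → 2 ≤ ∣ p ∣ → ∃ λ x → ∃ λ y → x ≢ y × x ∈ p × y ∈ p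
two-elements (true ∷ p) (s≤s ∣p∣>0) with nonempty p ∣p∣>0
... | y , y∈p = zero , suc y , (λ ()) , here , there y∈p
two-elements (false ∷ p) ∣p∣≥2 with two-elements p ∣p∣≥2
... | x , y , x≢y , x∈p , y∈p = suc x , suc y , x≢y ∘ Fin.suc-injective , there x∈p , there y∈p

fromList : List (Fin n) → Subset n
fromList []       = ⊥
fromList (x ∷ xs) = ⁅ x ⁆ ∪ fromList xs

∣fromList∣≤length : (xs : List (Fin n)) → ∣ fromList xs ∣ ≤ length xs
∣fromList∣≤length {n} []       = ≤-reflexive (∣⊥∣≡0 n)
∣fromList∣≤length (x ∷ xs) = begin
  ∣ ⁅ x ⁆ ∪ fromList xs ∣       ≤⟨ ∣p∪q∣≤∣p∣+∣q∣ ⁅ x ⁆ (fromList xs) ⟩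
  ∣ ⁅ x ⁆ ∣ + ∣ fromList xs ∣   ≤⟨ +-mono-≤ (≤-reflexive (∣⁅x⁆∣≡1 x)) (∣fromList∣≤length xs) ⟩
  suc (length xs)               ∎
  where open ≤-Reasoning

∈fromList : ∀ {x} (xs : List (Fin n)) → x ∈ₗ xs → x ∈ fromList xs
∈fromList (x ∷ xs) (here refl) = x∈p∪q⁺ (inj₁ (x∈⁅x⁆ x))
∈fromList (y ∷ xs) (there x∈)  = x∈p∪q⁺ (inj₂ (∈fromList xs x∈))

members : Subset n → List (Fin n)
members []          = []
members (true ∷ p)  = zero ∷ map suc (members p)
members (false ∷ p) = map suc (members p)

length-members : (p : Subset n) → length (members p) ≡ ∣ p ∣
length-members []          = refl
length-members (true ∷ p)  = cong suc (trans (length-map suc (members p)) (length-members p))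
length-members (false ∷ p) = trans (length-map suc (members p)) (length-members p)

members⊆ : (p : Subset n) → All (_∈ p) (members p)
members⊆ []          = []
members⊆ (true ∷ p)  = here ∷ All.map⁺ (All.map there (members⊆ p))
members⊆ (false ∷ p) = All.map⁺ (All.map there (members⊆ p))

members-unique : (p : Subset n) → Unique (members p)
members-unique []          = []
members-unique (true ∷ p)  = All.map⁺ (All.universal (λ _ ()) (members p)) ∷ Unique.map⁺ Fin.suc-injective (members-unique p)
members-unique (false ∷ p) = Unique.map⁺ Fin.suc-injective (members-unique p)

select : {P : Pred (Fin n) 0ℓ} → Decidable P → Subset n
select {n = zero}  P? = []
select {n = suc n} P? = does (P? zero) ∷ select (P? ∘ suc)

∈-select⁺ : {P : Pred (Fin n) 0ℓ} (P? : Decidable P) {x : Fin n} → P x → x ∈ select P?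
∈-select⁺ {n = suc n} P? {zero} px with P? zero
... | yes _   = here
... | no ¬px  = contradiction px ¬px
∈-select⁺ {n = suc n} P? {suc x} px = there (∈-select⁺ (P? ∘ suc) px)

∈-select⁻ : {P : Pred (Fin n) 0ℓ} (P? : Decidable P) {x : Fin n} → x ∈ select P? → P x
∈-select⁻ {n = suc n} P? {zero} x∈ with P? zero | x∈
... | yes px | _ = px
∈-select⁻ {n = suc n} P? {suc x} (there x∈) = ∈-select⁻ (P? ∘ suc) x∈

-- Counting uniform families by their trace outside a vertex set

link₀ : List (Subset (suc n)) → List (Subset n)
link₀ []                = []
link₀ ((true ∷ e) ∷ E)  = e ∷ link₀ E
link₀ ((false ∷ e) ∷ E) = link₀ E

avoid₀ : List (Subset (suc n)) → List (Subset n)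
avoid₀ []                = []
avoid₀ ((true ∷ e) ∷ E)  = avoid₀ E
avoid₀ ((false ∷ e) ∷ E) = e ∷ avoid₀ E

length-avoid₀+link₀ : (E : List (Subset (suc n))) → length E ≡ length (avoid₀ E) + length (link₀ E)
length-avoid₀+link₀ []                = refl
length-avoid₀+link₀ ((true ∷ e) ∷ E)  = trans (cong suc (length-avoid₀+link₀ E)) (sym (+-suc _ _))
length-avoid₀+link₀ ((false ∷ e) ∷ E) = cong suc (length-avoid₀+link₀ E)

module _ {P : Pred (Subset (suc n)) 0ℓ} {Q : Pred (Subset n) 0ℓ} where

  All-link₀ : (∀ {e} → P (true ∷ e) → Q e) → ∀ {E} → All P E → All Q (link₀ E)
  All-link₀ f {[]}                []       = []
  All-link₀ f {(true ∷ e) ∷ E}  (p ∷ ps) = f p ∷ All-link₀ f ps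
  All-link₀ f {(false ∷ e) ∷ E} (p ∷ ps) = All-link₀ f ps

  All-avoid₀ : (∀ {e} → P (false ∷ e) → Q e) → ∀ {E} → All P E → All Q (avoid₀ E)
  All-avoid₀ f {[]}                []       = []
  All-avoid₀ f {(true ∷ e) ∷ E}  (p ∷ ps) = All-avoid₀ f ps
  All-avoid₀ f {(false ∷ e) ∷ E} (p ∷ ps) = f p ∷ All-avoid₀ f ps

Unique-link₀ : {E : List (Subset (suc n))} → Unique E → Unique (link₀ E)
Unique-link₀ {E = []}                []       = []
Unique-link₀ {E = (true ∷ e) ∷ E}  (p ∷ ps) = All-link₀ (λ ≢e → ≢e ∘ cong (true ∷_)) p ∷ Unique-link₀ ps
Unique-link₀ {E = (false ∷ e) ∷ E} (p ∷ ps) = Unique-link₀ ps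

Unique-avoid₀ : {E : List (Subset (suc n))} → Unique E → Unique (avoid₀ E)
Unique-avoid₀ {E = []}                []       = []
Unique-avoid₀ {E = (true ∷ e) ∷ E}  (p ∷ ps) = Unique-avoid₀ ps
Unique-avoid₀ {E = (false ∷ e) ∷ E} (p ∷ ps) = All-avoid₀ (λ ≢e → ≢e ∘ cong (false ∷_)) p ∷ Unique-avoid₀ ps

∣p∣≡0⇒p≡⊥ : (p : Subset n) → ∣ p ∣ ≡ 0 → p ≡ ⊥
∣p∣≡0⇒p≡⊥ []          _     = refl
∣p∣≡0⇒p≡⊥ (false ∷ p) ∣p∣≡0 = cong (false ∷_) (∣p∣≡0⇒p≡⊥ p ∣p∣≡0)

length≤1-if-all-empty : {E : List (Subset n)} → Unique E → All (λ e → ∣ e ∣ ≡ 0) E → length E ≤ 1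
length≤1-if-all-empty {E = []}        _ _ = z≤n
length≤1-if-all-empty {E = _ ∷ []}    _ _ = ≤-refl
length≤1-if-all-empty {E = e ∷ f ∷ E} ((e≢f ∷ _) ∷ _) (∣e∣≡0 ∷ ∣f∣≡0 ∷ _) =
  contradiction (trans (∣p∣≡0⇒p≡⊥ e ∣e∣≡0) (sym (∣p∣≡0⇒p≡⊥ f ∣f∣≡0))) e≢f

length-All⊥ : {xs : List A} → All (λ _ → ⊥₀) xs → length xs ≡ 0
length-All⊥ [] = refl

count-inside : (T : Subset n) (j : ℕ) {E : List (Subset n)} → Unique E → All (λ e → ∣ e ∣ ≡ j) E →
  All (λ e → ∣ e ∩ ∁ T ∣ ≡ 0) E → length E ≤ ∣ T ∣ C j
count-inside T zero E-unique sizes _ = length≤1-if-all-empty E-unique sizes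
count-inside [] (suc j) {[]} _ _ _ = z≤n
count-inside [] (suc j) {[] ∷ E} _ (() ∷ _) _
count-inside (true ∷ T) (suc j) {E} E-unique sizes inside = begin
  length E                                 ≡⟨ length-avoid₀+link₀ E ⟩
  length (avoid₀ E) + length (link₀ E)     ≤⟨ +-mono-≤ avoiding through ⟩
  ∣ T ∣ C suc j + ∣ T ∣ C j                ≡⟨ +-comm _ (∣ T ∣ C j) ⟩
  ∣ T ∣ C j + ∣ T ∣ C suc j                ≡⟨ pascal ∣ T ∣ j ⟩
  suc ∣ T ∣ C suc j                        ∎
  where
  open ≤-Reasoning
  avoiding = count-inside T (suc j) (Unique-avoid₀ E-unique) (All-avoid₀ id sizes) (All-avoid₀ id inside)
  through  = count-inside T j (Unique-link₀ E-unique) (All-link₀ ℕ.suc-injective sizes) (All-link₀ id inside)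
count-inside (false ∷ T) (suc j) {E} E-unique sizes inside = begin
  length E                                 ≡⟨ length-avoid₀+link₀ E ⟩
  length (avoid₀ E) + length (link₀ E)     ≡⟨ cong (length (avoid₀ E) +_) (length-All⊥ (All-link₀ (λ ()) inside)) ⟩
  length (avoid₀ E) + 0                    ≡⟨ +-identityʳ _ ⟩
  length (avoid₀ E)                        ≤⟨ count-inside T (suc j) (Unique-avoid₀ E-unique) (All-avoid₀ id sizes) (All-avoid₀ id inside) ⟩
  ∣ T ∣ C suc j                            ∎
  where open ≤-Reasoning

count-≤1-outside : (T : Subset n) (j : ℕ) {E : List (Subset n)} → Unique E → All (λ e → ∣ e ∣ ≡ suc j) E →
  All (λ e → ∣ e ∩ ∁ T ∣ ≤ 1) E → length E ≤ ∣ T ∣ C suc j + ∣ ∁ T ∣ * (∣ T ∣ C j)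
count-≤1-outside [] j {[]} _ _ _ = z≤n
count-≤1-outside [] j {[] ∷ E} _ (() ∷ _) _
count-≤1-outside (true ∷ T) zero {E} E-unique sizes outside = begin
  length E                                   ≡⟨ length-avoid₀+link₀ E ⟩
  length (avoid₀ E) + length (link₀ E)       ≤⟨ +-mono-≤ avoiding through ⟩
  (∣ T ∣ C 1 + c * 1) + 1                    ≡⟨ +-comm (∣ T ∣ C 1 + c * 1) 1 ⟩
  (1 + ∣ T ∣ C 1) + c * 1                    ≡⟨ cong (_+ c * 1) (pascal ∣ T ∣ 0) ⟩
  suc ∣ T ∣ C 1 + c * (suc ∣ T ∣ C 0)        ∎
  where
  open ≤-Reasoning
  c = ∣ ∁ T ∣
  avoiding = count-≤1-outside T zero (Unique-avoid₀ E-unique) (All-avoid₀ id sizes) (All-avoid₀ id outside)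
  through  = length≤1-if-all-empty (Unique-link₀ E-unique) (All-link₀ ℕ.suc-injective sizes)
count-≤1-outside (true ∷ T) (suc j) {E} E-unique sizes outside = begin
  length E                                           ≡⟨ length-avoid₀+link₀ E ⟩
  length (avoid₀ E) + length (link₀ E)               ≤⟨ +-mono-≤ avoiding through ⟩
  (∣ T ∣ C suc (suc j) + c * (∣ T ∣ C suc j)) + (∣ T ∣ C suc j + c * (∣ T ∣ C j))
                                                     ≡⟨ regroup (∣ T ∣ C suc (suc j)) (∣ T ∣ C suc j) (∣ T ∣ C j) c ⟩
  (∣ T ∣ C suc j + ∣ T ∣ C suc (suc j)) + c * (∣ T ∣ C j + ∣ T ∣ C suc j)
                                                     ≡⟨ cong₂ (λ x y → x + c * y) (pascal ∣ T ∣ (suc j)) (pascal ∣ T ∣ j) ⟩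
  suc ∣ T ∣ C suc (suc j) + c * (suc ∣ T ∣ C suc j)  ∎
  where
  open ≤-Reasoning
  c = ∣ ∁ T ∣
  regroup : ∀ a b d c → (a + c * b) + (b + c * d) ≡ (b + a) + c * (d + b)
  regroup = solve-∀
  avoiding = count-≤1-outside T (suc j) (Unique-avoid₀ E-unique) (All-avoid₀ id sizes) (All-avoid₀ id outside)
  through  = count-≤1-outside T j (Unique-link₀ E-unique) (All-link₀ ℕ.suc-injective sizes) (All-link₀ id outside)
count-≤1-outside (false ∷ T) j {E} E-unique sizes outside = begin
  length E                                           ≡⟨ length-avoid₀+link₀ E ⟩
  length (avoid₀ E) + length (link₀ E)               ≤⟨ +-mono-≤ avoiding through ⟩
  (∣ T ∣ C suc j + c * (∣ T ∣ C j)) + ∣ T ∣ C j        ≡⟨ +-assoc (∣ T ∣ C suc j) _ _ ⟩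
  ∣ T ∣ C suc j + (c * (∣ T ∣ C j) + ∣ T ∣ C j)        ≡⟨ cong (∣ T ∣ C suc j +_) (+-comm _ (∣ T ∣ C j)) ⟩
  ∣ T ∣ C suc j + suc c * (∣ T ∣ C j)                  ∎
  where
  open ≤-Reasoning
  c = ∣ ∁ T ∣
  avoiding = count-≤1-outside T j (Unique-avoid₀ E-unique) (All-avoid₀ id sizes) (All-avoid₀ id outside)
  through  = count-inside T j (Unique-link₀ E-unique) (All-link₀ ℕ.suc-injective sizes) (All-link₀ (n≤0⇒n≡0 ∘ ≤-pred) outside)

degree : List (Subset n) → Fin n → ℕ
degree E x = length (filter (x ∈?_) E)

Meets : List (Fin n) → Subset n → Set
Meets vs e = Any (_∈ e) vs

meets? : (vs : List (Fin n)) → Decidable (Meets vs)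
meets? vs e = any? (_∈? e) vs

length-meeting≤Σdegree : (vs : List (Fin n)) (E : List (Subset n)) →
  length (filter (meets? vs) E) ≤ sum (map (degree E) vs)
length-meeting≤Σdegree []       E = ≤-reflexive (cong length (filter-none (meets? []) (All.universal (λ _ ()) E)))
length-meeting≤Σdegree (v ∷ vs) E = begin
  length E′                                                       ≤⟨ length≤filter+filter (v ∈?_) (meets? vs) split ⟩
  length (filter (v ∈?_) E′) + length (filter (meets? vs) E′)     ≤⟨ +-mono-≤ (length-filter∘filter≤ (v ∈?_) (meets? (v ∷ vs)) E)
                                                                                (length-filter∘filter≤ (meets? vs) (meets? (v ∷ vs)) E) ⟩
  degree E v + length (filter (meets? vs) E)                      ≤⟨ +-monoʳ-≤ (degree E v) (length-meeting≤Σdegree vs E) ⟩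
  degree E v + sum (map (degree E) vs)                            ∎
  where
  open ≤-Reasoning
  E′ = filter (meets? (v ∷ vs)) E
  split : All (λ e → v ∈ e ⊎ Meets vs e) E′
  split = All.map (λ { (here v∈e) → inj₁ v∈e ; (there m) → inj₂ m }) (all-filter (meets? (v ∷ vs)) E)

_∈ₗ?_ : (e : Subset n) (F : List (Subset n)) → Dec (e ∈ₗ F)
e ∈ₗ? F = DecMembership._∈?_ (Vec.≡-dec Bool._≟_) e F

module _ {E : List (Subset n)} (E-unique : Unique E) {r : ℕ} (E-uniform : All (λ e → ∣ e ∣ ≡ r) E) where

  fresh-edge-through : (F : List (Subset n)) (ws : List (Fin n)) {x : Fin n} → length F + length ws C r < degree E x →
    ∃ λ e → e ∈ₗ E × x ∈ e × e ∉ₗ F × ∃ λ w → w ∈ e × w ∉ₗ ws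
  fresh-edge-through F ws {x} many = decide (all? old? Ex)
    where
    T = fromList ws
    Ex = filter (x ∈?_) E
    inside? : Decidable (λ e → ∣ e ∩ ∁ T ∣ ≡ 0)
    inside? e = ∣ e ∩ ∁ T ∣ ≟ 0
    old? : Decidable (λ e → e ∈ₗ F ⊎ ∣ e ∩ ∁ T ∣ ≡ 0)
    old? e = (e ∈ₗ? F) ⊎-dec inside? e
    Ex-unique = Unique.filter⁺ (x ∈?_) E-unique

    few : All (λ e → e ∈ₗ F ⊎ ∣ e ∩ ∁ T ∣ ≡ 0) Ex → degree E x ≤ length F + length ws C r
    few all-old = begin
      length Ex                                                 ≤⟨ length≤filter+filter (_∈ₗ? F) inside? all-old ⟩
      length (filter (_∈ₗ? F) Ex) + length (filter inside? Ex)  ≤⟨ +-mono-≤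
        (unique⇒length≤ (Unique.filter⁺ (_∈ₗ? F) Ex-unique) (all-filter (_∈ₗ? F) Ex))
        (count-inside T r (Unique.filter⁺ inside? Ex-unique) (All.filter⁺ inside? (All.filter⁺ (x ∈?_) E-uniform)) (all-filter inside? Ex)) ⟩
      length F + ∣ T ∣ C r                                      ≤⟨ +-monoʳ-≤ (length F) (C-monoˡ-≤ r (∣fromList∣≤length ws)) ⟩
      length F + length ws C r                                  ∎
      where open ≤-Reasoning

    decide : Dec (All (λ e → e ∈ₗ F ⊎ ∣ e ∩ ∁ T ∣ ≡ 0) Ex) → ∃ λ e → e ∈ₗ E × x ∈ e × e ∉ₗ F × ∃ λ w → w ∈ e × w ∉ₗ ws
    decide (yes all-old) = contradiction (≤-trans many (few all-old)) (<-irrefl refl)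
    decide (no ¬all-old) with find (¬All⇒Any¬ old? Ex ¬all-old)
    ... | e , e∈Ex , new with ∈-filter⁻ (x ∈?_) {xs = E} e∈Ex | nonempty (e ∩ ∁ T) (n≢0⇒n>0 (new ∘ inj₂))
    ...   | e∈E , x∈e | w , w∈e∖T = e , e∈E , x∈e , new ∘ inj₁ , w , proj₁ w∈e×w∉T , proj₂ w∈e×w∉T ∘ ∈fromList ws
      where w∈e×w∉T = map₂ x∈∁p⇒x∉p (x∈p∩q⁻ e (∁ T) w∈e∖T)

interleave : (Fin m → A) → (Fin m → A) → List A
interleave {m = zero}  f g = []
interleave {m = suc m} f g = f zero ∷ g zero ∷ interleave (f ∘ suc) (g ∘ suc)

length-interleave : (f g : Fin m → A) → length (interleave f g) ≡ m + m
length-interleave {m = zero}  f g = refl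
length-interleave {m = suc m} f g = cong suc (trans (cong suc (length-interleave (f ∘ suc) (g ∘ suc))) (sym (+-suc m m)))

∈-interleave : (f g : Fin m → A) (i : Fin m) → f i ∈ₗ interleave f g × g i ∈ₗ interleave f g
∈-interleave {m = suc m} f g zero    = here refl , there (here refl)
∈-interleave {m = suc m} f g (suc i) with ∈-interleave (f ∘ suc) (g ∘ suc) i
... | fi∈ , gi∈ = there (there fi∈) , there (there gi∈)

All-interleave : {P : A → Set} (f g : Fin m → A) → (∀ i → P (f i) × P (g i)) → All P (interleave f g)
All-interleave {m = zero}  f g _ = []
All-interleave {m = suc m} f g P-fg = proj₁ (P-fg zero) ∷ proj₂ (P-fg zero) ∷ All-interleave (f ∘ suc) (g ∘ suc) (P-fg ∘ suc)

-- Berge matchings and their greedy extension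

record BergeMatching (E : List (Subset n)) (m : ℕ) : Set where
  field
    edge           : Fin m → Fin (length E)
    edge-injective : Injective _≡_ _≡_ edge
    u v            : Fin m → Fin n
    u≢v            : ∀ i → u i ≢ v i
    disjoint       : ∀ i j → i ≢ j → (u i ≢ u j) × (u i ≢ v j) × (v i ≢ v j)
    ends∈edge      : ∀ i → (u i ∈ lookup E (edge i)) × (v i ∈ lookup E (edge i))

  vertices : List (Fin n)
  vertices = interleave u v

  edges : List (Subset n)
  edges = tabulate (lookup E ∘ edge)

  hasBergeMatching : HasBergeMatching E m
  hasBergeMatching = edge , edge-injective , u , v , u≢v , disjoint , ends∈edge

open BergeMatching

empty : {E : List (Subset n)} → BergeMatching E 0
empty = record { edge = λ () ; edge-injective = λ { {()} } ; u = λ () ; v = λ ()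
               ; u≢v = λ () ; disjoint = λ () ; ends∈edge = λ () }

∉vertices : {E : List (Subset n)} (M : BergeMatching E m) {x : Fin n} → x ∉ₗ vertices M → ∀ i → x ≢ u M i × x ≢ v M i
∉vertices M x∉M i = ∉⇒≢ x∉M (proj₁ (∈-interleave (u M) (v M) i)) , ∉⇒≢ x∉M (proj₂ (∈-interleave (u M) (v M) i))

extend : {E : List (Subset n)} (M : BergeMatching E m) {e : Subset n} {a b : Fin n} →
  e ∈ₗ E → e ∉ₗ edges M → a ≢ b → a ∈ e → b ∈ e → a ∉ₗ vertices M → b ∉ₗ vertices M →
  BergeMatching E (suc m)
extend {n = n} {m = m} {E = E} M {e} {a} {b} e∈E e∉M a≢b a∈e b∈e a∉M b∉M = record
  { edge = edge′ ; edge-injective = edge′-injective ; u = u′ ; v = v′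
  ; u≢v = u′≢v′ ; disjoint = disjoint′ ; ends∈edge = ends∈edge′ }
  where
  e≡ : e ≡ lookup E (index e∈E)
  e≡ = lookup-index e∈E
  edge′ : Fin (suc m) → Fin (length E)
  edge′ zero    = index e∈E
  edge′ (suc i) = edge M i
  u′ v′ : Fin (suc m) → Fin n
  u′ zero    = a
  u′ (suc i) = u M i
  v′ zero    = b
  v′ (suc i) = v M i
  new-edge : ∀ i → index e∈E ≢ edge M i
  new-edge i eq = e∉M (subst (_∈ₗ edges M) (sym (trans e≡ (cong (lookup E) eq))) (∈-tabulate⁺ i))
  edge′-injective : Injective _≡_ _≡_ edge′
  edge′-injective {zero}  {zero}  _  = refl
  edge′-injective {zero}  {suc j} eq = contradiction eq (new-edge j)
  edge′-injective {suc i} {zero}  eq = contradiction (sym eq) (new-edge i)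
  edge′-injective {suc i} {suc j} eq = cong suc (edge-injective M eq)
  u′≢v′ : ∀ i → u′ i ≢ v′ i
  u′≢v′ zero    = a≢b
  u′≢v′ (suc i) = u≢v M i
  a≢ = ∉vertices M a∉M
  b≢ = ∉vertices M b∉M
  disjoint′ : ∀ i j → i ≢ j → (u′ i ≢ u′ j) × (u′ i ≢ v′ j) × (v′ i ≢ v′ j)
  disjoint′ zero    zero    i≢j = contradiction refl i≢j
  disjoint′ zero    (suc j) _   = proj₁ (a≢ j) , proj₂ (a≢ j) , proj₂ (b≢ j)
  disjoint′ (suc i) zero    _   = proj₁ (a≢ i) ∘ sym , proj₁ (b≢ i) ∘ sym , proj₂ (b≢ i) ∘ sym
  disjoint′ (suc i) (suc j) i≢j = disjoint M i j (i≢j ∘ cong suc)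
  ends∈edge′ : ∀ i → (u′ i ∈ lookup E (edge′ i)) × (v′ i ∈ lookup E (edge′ i))
  ends∈edge′ zero    = subst (a ∈_) e≡ a∈e , subst (b ∈_) e≡ b∈e
  ends∈edge′ (suc i) = ends∈edge M i

Wide : Subset n → Subset n → Set
Wide L e = 2 ≤ ∣ e ∩ ∁ L ∣

wide? : (L : Subset n) → Decidable (Wide L)
wide? L e = 2 ≤? ∣ e ∩ ∁ L ∣

reduce-lift : {E : List (Subset n)} (S : Subset n) → HasBergeMatching (reduce S E) m →
  Σ (BergeMatching E m) λ M → All (_∉ S) (vertices M)
reduce-lift {E = E} S (f , f-injective , u , v , u≢v , disjoint , ends∈edge) = M , All-interleave u v avoid-S
  where
  position = map∘filter-position (_─ S) (wide? S) E
  pos = proj₁ position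
  in-E : ∀ i {x} → x ∈ lookup (reduce S E) (f i) → x ∈ lookup E (pos (f i)) × x ∉ S
  in-E i x∈ with subst (_ ∈_) (proj₂ (proj₂ position) (f i)) x∈
  ... | x∈e─S = p─q⊆p _ S x∈e─S , x∈p─q⇒x∉q x∈e─S
  M : BergeMatching E _
  M = record { edge = pos ∘ f ; edge-injective = f-injective ∘ proj₁ (proj₂ position)
             ; u = u ; v = v ; u≢v = u≢v ; disjoint = disjoint
             ; ends∈edge = λ i → proj₁ (in-E i (proj₁ (ends∈edge i))) , proj₁ (in-E i (proj₂ (ends∈edge i))) }
  avoid-S : ∀ i → u i ∉ S × v i ∉ S
  avoid-S i = proj₂ (in-E i (proj₁ (ends∈edge i))) , proj₂ (in-E i (proj₂ (ends∈edge i)))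

module _ {E : List (Subset n)} (E-unique : Unique E) {r : ℕ} (E-uniform : All (λ e → ∣ e ∣ ≡ r) E) (K : ℕ) where

  -- The threshold leaves room for K used edges and all r-sets inside 2K blocked vertices.
  Rich : Fin n → Set
  Rich x = K + (2 * K) C r < degree E x

  blocking-budget : (M : BergeMatching E m) (x : Fin n) (xs : List (Fin n)) → m + length (x ∷ xs) ≤ K →
    length (edges M) + length (x ∷ xs ++ vertices M) C r ≤ K + (2 * K) C r
  blocking-budget {m = m} M x xs fits = +-mono-≤ (≤-trans (≤-reflexive (length-tabulate _)) m≤K) (C-monoˡ-≤ r (begin
    length (x ∷ xs ++ vertices M)          ≡⟨ cong suc (length-++ xs) ⟩
    suc (length xs + length (vertices M))  ≡⟨ cong (λ l → suc (length xs + l)) (length-interleave (u M) (v M)) ⟩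
    suc (length xs + (m + m))              ≡⟨ regroup (length xs) m ⟩
    (m + suc (length xs)) + m              ≤⟨ +-mono-≤ fits m≤K ⟩
    K + K                                  ≡⟨ cong (K +_) (+-identityʳ K) ⟨
    2 * K                                  ∎))
    where
    open ≤-Reasoning
    m≤K : m ≤ K
    m≤K = ≤-trans (m≤m+n m _) fits
    regroup : ∀ a m → suc (a + (m + m)) ≡ (m + suc a) + m
    regroup = solve-∀

  extend-through : (xs : List (Fin n)) → Unique xs → All Rich xs → (M : BergeMatching E m) →
    All (_∉ₗ vertices M) xs → m + length xs ≤ K → BergeMatching E (m + length xs)
  extend-through [] _ _ M _ _ = subst (BergeMatching E) (sym (+-identityʳ _)) M
  extend-through {m = m} (x ∷ xs) (x∉xs ∷ xs-unique) (rich ∷ riches) M (x∉M ∷ xs∉M) fits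
    with fresh-edge-through E-unique E-uniform (edges M) (x ∷ xs ++ vertices M) (≤-<-trans (blocking-budget M x xs fits) rich)
  ... | e , e∈E , x∈e , e∉M , w , w∈e , w∉ws =
    subst (BergeMatching E) (sym (+-suc m (length xs)))
      (extend-through xs xs-unique riches M′ xs∉M′ (subst (_≤ K) (+-suc m (length xs)) fits))
    where
    M′ = extend M e∈E e∉M (λ x≡w → w∉ws (here (sym x≡w))) x∈e w∈e x∉M (w∉ws ∘ there ∘ ∈-++⁺ʳ xs)
    w∉xs : All (w ≢_) xs
    w∉xs = ¬Any⇒All¬ xs (w∉ws ∘ there ∘ ∈-++⁺ˡ)
    fresh : ∀ {y} → x ≢ y × w ≢ y × y ∉ₗ vertices M → y ∉ₗ vertices M′
    fresh (x≢y , w≢y , y∉M) (here y≡x)          = x≢y (sym y≡x)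
    fresh (x≢y , w≢y , y∉M) (there (here y≡w))  = w≢y (sym y≡w)
    fresh (x≢y , w≢y , y∉M) (there (there y∈M)) = y∉M y∈M
    xs∉M′ : All (_∉ₗ vertices M′) xs
    xs∉M′ = All.map fresh (All.zip (x∉xs , All.zip (w∉xs , xs∉M)))

module _ {E : List (Subset n)} (L : Subset n) {Δ : ℕ} (sparse : ∀ {x} → x ∉ L → degree E x ≤ Δ) where

  untouched-wide-edge : (M : BergeMatching E m) → All (_∉ L) (vertices M) → (m + m) * Δ < length (filter (wide? L) E) →
    ∃ λ e → e ∈ₗ filter (wide? L) E × ¬ Meets (vertices M) e
  untouched-wide-edge {m = m} M M∉L many with all? (meets? (vertices M)) (filter (wide? L) E)
  ... | no ¬all-meet = find (¬All⇒Any¬ (meets? (vertices M)) _ ¬all-meet)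
  ... | yes all-meet = contradiction (≤-<-trans few many) (<-irrefl refl)
    where
    open ≤-Reasoning
    W = filter (wide? L) E
    few : length W ≤ (m + m) * Δ
    few = begin
      length W                                ≡⟨ cong length (filter-all (meets? (vertices M)) all-meet) ⟨
      length (filter (meets? (vertices M)) W) ≤⟨ length-meeting≤Σdegree (vertices M) W ⟩
      sum (map (degree W) (vertices M))       ≤⟨ sum≤length* (degree W) (All.map (λ v∉L → ≤-trans (length-filter∘filter≤ _ (wide? L) E) (sparse v∉L)) M∉L) ⟩
      length (vertices M) * Δ                 ≡⟨ cong (_* Δ) (length-interleave (u M) (v M)) ⟩
      (m + m) * Δ                             ∎

  matching-in-wide : ∀ m → (m + m) * Δ < length (filter (wide? L) E) → Σ (BergeMatching E m) λ M → All (_∉ L) (vertices M)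
  matching-in-wide zero _ = empty , []
  matching-in-wide (suc m) many with matching-in-wide m (≤-<-trans (*-monoˡ-≤ Δ (+-mono-≤ (n≤1+n m) (n≤1+n m))) many)
  ... | M , M∉L with untouched-wide-edge M M∉L (≤-<-trans (*-monoˡ-≤ Δ (+-mono-≤ (n≤1+n m) (n≤1+n m))) many)
  ...   | e , e∈W , misses with ∈-filter⁻ (wide? L) {xs = E} e∈W
  ...     | e∈E , wide with two-elements (e ∩ ∁ L) wide
  ...       | a , b , a≢b , a∈e∖L , b∈e∖L = extend M e∈E e∉M a≢b (in-e a∈e∖L) (in-e b∈e∖L) (off a∈e∖L) (off b∈e∖L) ,
                                           out-L a∈e∖L ∷ out-L b∈e∖L ∷ M∉L
    where
    in-e : ∀ {x} → x ∈ e ∩ ∁ L → x ∈ e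
    in-e = proj₁ ∘ x∈p∩q⁻ e (∁ L)
    out-L : ∀ {x} → x ∈ e ∩ ∁ L → x ∉ L
    out-L = x∈∁p⇒x∉p ∘ proj₂ ∘ x∈p∩q⁻ e (∁ L)
    off : ∀ {x} → x ∈ e ∩ ∁ L → x ∉ₗ vertices M
    off x∈e∖L x∈M = misses (Any.map (λ { refl → in-e x∈e∖L }) x∈M)
    e∉M : e ∉ₗ edges M
    e∉M e∈M with ∈-tabulate⁻ e∈M
    ... | i , refl = misses (Any.map (λ { refl → proj₁ (ends∈edge M i) }) (proj₁ (∈-interleave (u M) (v M) i)))

-- The core of rich vertices

module RichCore {E : List (Subset n)} (E-unique : Unique E) {r : ℕ} (E-uniform : All (λ e → ∣ e ∣ ≡ r) E)
                (K : ℕ) (E-free : BergeMatchingFree E K) where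

  Δ : ℕ
  Δ = K + (2 * K) C r

  core : Subset n
  core = select (λ x → Δ <? degree E x)

  core-rich : All (Rich E-unique E-uniform K) (members core)
  core-rich = All.map (∈-select⁻ (λ x → Δ <? degree E x)) (members⊆ core)

  outside-sparse : ∀ {x} → x ∉ core → degree E x ≤ Δ
  outside-sparse x∉core = ≮⇒≥ (x∉core ∘ ∈-select⁺ (λ x → Δ <? degree E x))

  ∣core∣<K : ∣ core ∣ < K
  ∣core∣<K = ≰⇒> too-many
    where
    too-many : K ≤ ∣ core ∣ → ⊥₀
    too-many K≤∣core∣ = E-free (subst (HasBergeMatching E) length-xs (hasBergeMatching M))
      where
      xs = take K (members core)
      length-xs : length xs ≡ K
      length-xs = trans (length-take K (members core)) (m≤n⇒m⊓n≡m (subst (K ≤_) (sym (length-members core)) K≤∣core∣))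
      M = extend-through E-unique E-uniform K xs (Unique.take⁺ K (members-unique core)) (All.take⁺ K core-rich)
            empty (All.universal (λ _ ()) xs) (≤-reflexive length-xs)

  reduce-core-free : BergeMatchingFree (reduce core E) (K ∸ ∣ core ∣)
  reduce-core-free has-M₀ with reduce-lift core has-M₀
  ... | M₀ , M₀∉core = E-free (subst (HasBergeMatching E) size (hasBergeMatching M))
    where
    size : (K ∸ ∣ core ∣) + length (members core) ≡ K
    size = trans (cong (K ∸ ∣ core ∣ +_) (length-members core)) (m∸n+n≡m (<⇒≤ ∣core∣<K))
    core∉M₀ : All (_∉ₗ vertices M₀) (members core)
    core∉M₀ = All.map (λ x∈core x∈M₀ → All.lookup M₀∉core x∈M₀ x∈core) (members⊆ core)
    M = extend-through E-unique E-uniform K (members core) (members-unique core) core-rich M₀ core∉M₀ (≤-reflexive size)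

  few-wide : length (filter (wide? core) E) ≤ (K + K) * Δ
  few-wide = ≮⇒≥ λ many → E-free (hasBergeMatching (proj₁ (matching-in-wide {E = E} core outside-sparse K many)))

  length≤ : ∀ {j} → r ≡ suc j → length E ≤ (K + K) * Δ + (∣ core ∣ C suc j + ∣ ∁ core ∣ * (∣ core ∣ C j))
  length≤ {j} refl = begin
    length E                                                         ≤⟨ length≤filter+filter (wide? core) narrow? (All.universal (toSum ∘ wide? core) E) ⟩
    length (filter (wide? core) E) + length (filter narrow? E)        ≤⟨ +-mono-≤ few-wide
      (count-≤1-outside core j (Unique.filter⁺ narrow? E-unique) (All.filter⁺ narrow? E-uniform)
        (All.map (λ ¬wide → ≤-pred (≰⇒> ¬wide)) (all-filter narrow? E))) ⟩
    (K + K) * Δ + (∣ core ∣ C suc j + ∣ ∁ core ∣ * (∣ core ∣ C j))  ∎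
    where
    open ≤-Reasoning
    narrow? = ¬? ∘ wide? core

slack : ∀ K₂ N a b n t → suc a ≤ b → N + (K₂ + N * a) ≤ n → K₂ + n * a ≤ (n + t ∸ N) * b
slack K₂ N a b n t a<b n-large = begin
  K₂ + n * a            ≡⟨ cong (λ n → K₂ + n * a) n≡N+p ⟩
  K₂ + (N + p) * a      ≡⟨ regroup K₂ N p a ⟩
  (K₂ + N * a) + p * a  ≤⟨ +-monoˡ-≤ (p * a) K₂+Na≤p ⟩
  p + p * a             ≡⟨ *-suc p a ⟨
  p * suc a             ≤⟨ *-mono-≤ (∸-monoˡ-≤ N (m≤m+n n t)) a<b ⟩
  (n + t ∸ N) * b       ∎
  where
  open ≤-Reasoning
  p = n ∸ N
  n≡N+p : n ≡ N + p
  n≡N+p = sym (m+[n∸m]≡n (m+n≤o⇒m≤o N n-large))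
  K₂+Na≤p : K₂ + N * a ≤ p
  K₂+Na≤p = m+n≤o⇒m≤o∸n (K₂ + N * a) (subst (_≤ n) (+-comm N _) n-large)
  regroup : ∀ K₂ N p a → K₂ + (N + p) * a ≡ (K₂ + N * a) + p * a
  regroup = solve-∀

-- Trading n C(t − 1, r − 1) for (n − 2k − 1 + t) C(t, r − 1) gains about n, since
-- C(t, r − 1) > C(t − 1, r − 1) for r ≥ 2; this pays for the constant K₂ once n is large.
h-dominates : ∀ {k i l c n K₂} t → (let N = 2 * k + 1) → suc (suc i) ≤ t ∸ 1 → t ≤ k → l < t → c ≤ n →
  N + (K₂ + N * ((t ∸ 1) C suc i)) ≤ n →
  K₂ + (l C suc (suc i) + c * (l C suc i)) ≤ h (suc (suc i)) n k t
h-dominates {k} {i} {l} {c} {n} {K₂} (suc t′) r≤t′ t≤k (s≤s l≤t′) c≤n n-large = begin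
  K₂ + (l C r + c * (l C j))            ≡⟨ swap K₂ (l C r) (c * (l C j)) ⟩
  l C r + (K₂ + c * (l C j))            ≤⟨ +-mono-≤ (C-monoˡ-≤ r l≤N∸t) (+-monoʳ-≤ K₂ (*-mono-≤ c≤n (C-monoˡ-≤ j l≤t′))) ⟩
  (N ∸ t) C r + (K₂ + n * (t′ C j))     ≤⟨ +-monoʳ-≤ ((N ∸ t) C r) (slack K₂ N (t′ C j) (t C j) n t t′Cj<tCj n-large) ⟩
  (N ∸ t) C r + (n + t ∸ N) * (t C j)   ∎
  where
  open ≤-Reasoning
  t = suc t′
  j = suc i
  r = suc j
  N = 2 * k + 1
  swap : ∀ a b c → a + (b + c) ≡ b + (a + c)
  swap = solve-∀
  l≤N∸t : l ≤ N ∸ t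
  l≤N∸t = m+n≤o⇒m≤o∸n l (begin
    l + t            ≤⟨ +-mono-≤ (≤-trans l≤t′ (n≤1+n t′)) t≤k ⟩
    t + k            ≤⟨ +-monoˡ-≤ k t≤k ⟩
    k + k            ≤⟨ m≤m+n (k + k) 1 ⟩
    k + k + 1        ≡⟨ cong (λ x → k + x + 1) (+-identityʳ k) ⟨
    N                ∎)
  t′Cj<tCj : suc (t′ C j) ≤ t C j
  t′Cj<tCj = begin
    suc (t′ C j)       ≤⟨ +-monoˡ-≤ (t′ C j) (C-pos i (≤-trans (n≤1+n i) (≤-trans (n≤1+n (suc i)) r≤t′))) ⟩
    t′ C i + t′ C j    ≡⟨ pascal t′ i ⟩
    t C j              ∎

theorem1p7 : (q k r : ℕ) → 2 * q + 3 ≤ k → 2 ≤ r → r ≤ k ∸ q ∸ 1 →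
    Σ ℕ λ n₀ → (n : ℕ) → n₀ ≤ n →
      (E : List (Subset n)) → Unique E → All (λ e → ∣ e ∣ ≡ r) E →
      BergeMatchingFree E (k + 1) →
      h r n k (k ∸ q) < length E →
      Σ (Subset n) λ S → (k ∸ q ≤ ∣ S ∣) × (∣ S ∣ ≤ k) ×
        BergeMatchingFree (reduce S E) (k + 1 ∸ ∣ S ∣)
theorem1p7 q k 0 _ () _
theorem1p7 q k 1 _ (s≤s ()) _
theorem1p7 q k (suc (suc i)) _ _ r≤t∸1 = n₀ , λ n n₀≤n E E-unique E-uniform E-free many →
  let open RichCore E-unique E-uniform K E-free
      small-core⇒few-edges : ∣ core ∣ < t → length E ≤ h r n k t
      small-core⇒few-edges ∣core∣<t =
        ≤-trans (length≤ refl) (h-dominates t r≤t∸1 (m∸n≤m k q) ∣core∣<t (∣p∣≤n (∁ core)) n₀≤n)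
  in core , ≮⇒≥ (λ ∣core∣<t → <⇒≱ many (small-core⇒few-edges ∣core∣<t)) ,
     m<1+n⇒m≤n (subst (∣ core ∣ <_) (+-comm k 1) ∣core∣<K) , reduce-core-free
  where
  r = suc (suc i)
  t = k ∸ q
  K = k + 1
  N = 2 * k + 1
  n₀ = N + ((K + K) * (K + (2 * K) C r) + N * ((t ∸ 1) C suc i))
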